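{- For every positive integer $n$, the number of generalized wreath circulant digraphs of order $n$ is at most $$\sum_{p\mid n}2^{n/p-1}\Bigl(\sum_{q\mid (n/p)}2^{(n-n/p)/q}\Bigr),$$ where $p$ and $q$ range over primes.
   Context: A circulant digraph of order $n$ is $\Gamma(\mathbb{Z}_n,S)$ with vertex set $\mathbb{Z}_n$, arc set $\{(u,v):u-v\in S\}$, $S\subseteq\mathbb{Z}_n\setminus\{0\}$, counted as labelled objects (by connection set $S$). It is a generalized wreath circulant digraph if there are subgroups $\{0\}\ne K\le H\ne\mathbb{Z}_n$ of $\mathbb{Z}_n$ with $S\setminus H$ a union of cosets of $K$. -}

module Defs where

open import Data.Nat using (ℕ; zero; suc; _+_; _*_; _∸_; _^_; _/_)
open import Data.Nat.DivMod using (_mod_)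
open import Data.Nat.Divisibility using (_∣_; _∣?_)
open import Data.Nat.Primality using (Prime; prime?)
open import Data.Fin using (Fin; toℕ)
open import Data.Fin.Subset using (Subset; _∈_; _∉_; _⊆_; inside; outside)
open import Data.Fin.Subset.Properties using (_∈?_; anySubset?)
open import Data.Fin.Properties using (all?; any?)
open import Data.List using (List; []; _∷_; _++_; map; filter; length; upTo)
open import Data.Nat.ListAction using (sum)
open import Data.Vec using (_∷_; [])
open import Data.Product using (Σ; ∃; _×_; _,_)
open import Relation.Nullary using (¬_; Dec; yes; no)
open import Relation.Nullary.Decidable using (_×-dec_; ¬?; _→-dec_)
open import Relation.Binary.PropositionalEquality using (_≡_; _≢_)
open import Data.Fin.Properties using (_≟_)

module _ (m : ℕ) where
  private
    n : ℕ
    n = suc m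

  0ₙ : Fin n
  0ₙ = Fin.zero

  infixl 6 _+ₙ_
  _+ₙ_ : Fin n → Fin n → Fin n
  a +ₙ b = (toℕ a + toℕ b) mod n

  -ₙ_ : Fin n → Fin n
  -ₙ a = (n ∸ toℕ a) mod n

  IsSubgroup : Subset n → Set
  IsSubgroup H = (0ₙ ∈ H)
               × (∀ x y → x ∈ H → y ∈ H → (x +ₙ y) ∈ H)
               × (∀ x → x ∈ H → (-ₙ x) ∈ H)

  -- S ∖ H is a union of cosets of K, i.e. x + K ⊆ S ∖ H for every x ∈ S ∖ H
  -- (a subset is a union of K-cosets iff it contains the K-coset of each of its elements)
  DiffIsUnionOfCosets : Subset n → Subset n → Subset n → Set
  DiffIsUnionOfCosets S H K =
    ∀ x → x ∈ S → x ∉ H → ∀ k → k ∈ K → ((x +ₙ k) ∈ S × (x +ₙ k) ∉ H)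

  -- Γ(Z_n, S) is a generalized wreath circulant digraph:
  -- there are subgroups {0} ≠ K ≤ H ≠ Z_n with S ∖ H a union of K-cosets.
  IsGWC : Subset n → Set
  IsGWC S = ∃ λ H → ∃ λ K →
      IsSubgroup H × IsSubgroup K
    × (∃ λ k → k ∈ K × k ≢ 0ₙ)
    × K ⊆ H
    × (∃ λ x → x ∉ H)
    × DiffIsUnionOfCosets S H K

  IsConnectionSet : Subset n → Set
  IsConnectionSet S = 0ₙ ∉ S

  private
    ∈⇒? : ∀ {ℓ} {P : Set ℓ} (x : Fin n) (A : Subset n) → Dec P → Dec (x ∈ A → P)
    ∈⇒? x A d = (x ∈? A) →-dec d

  isSubgroup? : ∀ H → Dec (IsSubgroup H)
  isSubgroup? H = (0ₙ ∈? H)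
    ×-dec all? (λ x → all? (λ y → ∈⇒? x H (∈⇒? y H ((x +ₙ y) ∈? H))))
    ×-dec all? (λ x → ∈⇒? x H ((-ₙ x) ∈? H))

  diff? : ∀ S H K → Dec (DiffIsUnionOfCosets S H K)
  diff? S H K = all? (λ x → ∈⇒? x S ((¬? (x ∈? H)) →-dec
    all? (λ k → ∈⇒? k K (((x +ₙ k) ∈? S) ×-dec ¬? ((x +ₙ k) ∈? H)))))

  ⊆? : ∀ (K H : Subset n) → Dec (K ⊆ H)
  ⊆? K H = Relation.Nullary.Decidable.map′ (λ f {x} → f x) (λ f x → f {x})
             (all? (λ x → ∈⇒? x K (x ∈? H)))
    where import Relation.Nullary.Decidable

  isGWC? : ∀ S → Dec (IsGWC S)
  isGWC? S = anySubset? (λ H → anySubset? (λ K →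
      isSubgroup? H ×-dec isSubgroup? K
    ×-dec any? (λ k → (k ∈? K) ×-dec ¬? (k ≟ 0ₙ))
    ×-dec ⊆? K H
    ×-dec any? (λ x → ¬? (x ∈? H))
    ×-dec diff? S H K))

  isConnectionSet? : ∀ S → Dec (IsConnectionSet S)
  isConnectionSet? S = ¬? (0ₙ ∈? S)

allSubsets : (k : ℕ) → List (Subset k)
allSubsets zero = [] ∷ []
allSubsets (suc k) = map (inside ∷_) (allSubsets k) ++ map (outside ∷_) (allSubsets k)

-- number of generalized wreath circulant digraphs of order n = suc m
-- (labelled, i.e. counted by connection set S ⊆ Z_n ∖ {0})
numGWC : (m : ℕ) → ℕ
numGWC m = length (filter (λ S → isConnectionSet? m S ×-dec isGWC? m S) (allSubsets (suc m)))

-- Σ_{p ∣ k, p prime} f p : p ranges over 1 .. k (as suc i, i < k)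

sumPrimeDiv : (k : ℕ) → ((p : ℕ) → .{{_ : Data.Nat.NonZero p}} → ℕ) → ℕ
sumPrimeDiv k f =
  sum (map (λ i → f (suc i)) (filter (λ i → prime? (suc i) ×-dec (suc i ∣? k)) (upTo k)))
  where import Data.Nat

gwcBound : ℕ → ℕ
gwcBound n = sumPrimeDiv n (λ p →
  2 ^ (n / p ∸ 1) * sumPrimeDiv (n / p) (λ q → 2 ^ ((n ∸ n / p) / q)))

-- A witness K ≤ H for S gives two primes. H is proper, so it lies in pℤₙ for a prime p ∣ n; K is
-- nontrivial, so it contains n/q for a prime q with pq ∣ n. As S ∖ H is a union of K-cosets, S is
-- closed under x ↦ x + n/q at every x ∉ pℤₙ. Since p ∣ n/q, off pℤₙ the set S is a union of orbits of
-- this shift, each meeting [1, n/q). Hence S is determined by its values at 1, …, n/q - 1 and at the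
-- multiples of p in [n/q, n): that is n/p - 1 + (n - n/p)/q positions. Summing over (p, q) gives the bound.

module Submission where

open import Defs
open import Data.Nat
  using (ℕ; zero; suc; _+_; _*_; _∸_; _^_; _/_; _%_; _≤_; _<_; _<?_; z≤n; s≤s; s<s⁻¹;
         NonZero; >-nonZero; ≢-nonZero)
open import Data.Nat.Properties
open import Data.Nat.DivMod
  using (_mod_; m%n<n; m<n⇒m%n≡m; [m+kn]%n≡m%n; %-distribˡ-+; n%n≡0; m≡m%n+[m/n]*n;
         m*n/n≡m; m*[n/m]≡n; m≥n⇒m/n>0; m<n*o⇒m/o<n)
open import Data.Nat.Divisibility
open import Data.Nat.GCD using (gcd; gcd[m,n]∣m; gcd[m,n]∣n; gcd-greatest; gcd-GCD; module Bézout)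
open import Data.Nat.Primality using (Prime; prime?; ¬prime[0])
open import Data.Nat.Primality.Factorisation using (factorise)
open import Data.Nat.Solver using (module +-*-Solver)
open import Data.Nat.ListAction using (sum; product)
open import Data.Bool using (true; false)
open import Data.Fin using (Fin; toℕ; fromℕ<; splitAt; _↑ˡ_; _↑ʳ_)
open import Data.Fin.Properties
  using (toℕ-injective; toℕ-fromℕ<; toℕ<n; splitAt-↑ˡ; splitAt-↑ʳ; all?)
open import Data.Fin.Subset using (Subset; inside; outside; _∈_; _∉_; _⊆_)
open import Data.Fin.Subset.Properties using (_∈?_; ⊆-antisym)
open import Data.List using (List; []; _∷_; _++_; map; filter; length; foldr; allFin; upTo)
open import Data.List.Properties
  using (length-map; length-++; length-removeAt′; filter-accept; filter-none;
         foldr-preservesᵇ; foldr-preservesᵒ)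
open import Data.List.Membership.Propositional using (_─_; lose) renaming (_∈_ to _∈ᴸ_)
open import Data.List.Membership.Propositional.Properties
  using (∈-map⁺; ∈-map⁻; ∈-++⁺ˡ; ∈-++⁺ʳ; ∈-filter⁺; ∈-filter⁻; ∈-allFin; ∈-upTo⁺)
open import Data.List.Relation.Unary.Any as Any using (Any; here; there; index)
open import Data.List.Relation.Unary.All as All using (All)
import Data.List.Relation.Unary.All.Properties as All
open import Data.List.Relation.Unary.AllPairs using ([]; _∷_)
open import Data.List.Relation.Unary.Unique.Propositional using (Unique)
import Data.List.Relation.Unary.Unique.Propositional.Properties as Unique
open import Data.Vec using ([]; _∷_; lookup; tabulate)
open import Data.Vec.Properties using (∷-injectiveʳ; lookup∘tabulate; []=⇒lookup; lookup⇒[]=)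
open import Data.Product using (∃; ∃₂; _×_; _,_; proj₁; proj₂)
open import Data.Sum using (_⊎_; inj₁; inj₂; [_,_]′)
open import Data.Empty using (⊥-elim)
open import Function using (_∘_)
open import Relation.Nullary using (¬_; yes; no; contradiction; ¬?; _×-dec_; _→-dec_)
open import Relation.Unary using (Decidable)
open import Relation.Binary.PropositionalEquality hiding ([_])

module _ {A : Set} where

  ∈-─ : ∀ {x y : A} {xs} (x∈xs : x ∈ᴸ xs) → y ∈ᴸ xs → y ≢ x → y ∈ᴸ xs ─ x∈xs
  ∈-─ (here refl) (here refl) y≢x = ⊥-elim (y≢x refl)
  ∈-─ (here refl) (there y∈xs) _ = y∈xs
  ∈-─ (there x∈xs) (here refl) _ = here refl
  ∈-─ (there x∈xs) (there y∈xs) y≢x = there (∈-─ x∈xs y∈xs y≢x)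

  unique∧⊆⇒length≤ : ∀ {xs ys : List A} → Unique xs → (∀ {y} → y ∈ᴸ xs → y ∈ᴸ ys) →
                     length xs ≤ length ys
  unique∧⊆⇒length≤ {[]} _ _ = z≤n
  unique∧⊆⇒length≤ {x ∷ xs} {ys} (x∉xs ∷ xs!) xs⊆ys = begin
    suc (length xs)          ≤⟨ s≤s (unique∧⊆⇒length≤ xs! xs⊆ys─x) ⟩
    suc (length (ys ─ x∈ys)) ≡⟨ length-removeAt′ ys (index x∈ys) ⟨
    length ys                ∎
    where
    open ≤-Reasoning
    x∈ys : x ∈ᴸ ys
    x∈ys = xs⊆ys (here refl)
    xs⊆ys─x : ∀ {y} → y ∈ᴸ xs → y ∈ᴸ ys ─ x∈ys
    xs⊆ys─x y∈xs = ∈-─ x∈ys (xs⊆ys (there y∈xs)) (All.lookup x∉xs y∈xs ∘ sym)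

  map-unique : ∀ {B : Set} (f : A → B) {xs} → (∀ {x y} → x ∈ᴸ xs → y ∈ᴸ xs → f x ≡ f y → x ≡ y) →
               Unique xs → Unique (map f xs)
  map-unique f _ [] = []
  map-unique f inj (x∉xs ∷ xs!) =
    All.map⁺ (All.tabulate λ y∈xs fx≡fy → All.lookup x∉xs y∈xs (inj (here refl) (there y∈xs) fx≡fy))
    ∷ map-unique f (λ x∈ y∈ → inj (there x∈) (there y∈)) xs!

  length-filter-∷ : ∀ {P : A → Set} (P? : Decidable P) x xs →
                    length (filter P? xs) ≤ length (filter P? (x ∷ xs))
  length-filter-∷ P? x xs with P? x
  ... | yes _ = n≤1+n _
  ... | no _ = ≤-refl

  length-filter-⊎ : ∀ {R P Q : A → Set} (R? : Decidable R) (P? : Decidable P) (Q? : Decidable Q) →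
                    (∀ {x} → R x → P x ⊎ Q x) → ∀ xs →
                    length (filter R? xs) ≤ length (filter P? xs) + length (filter Q? xs)
  length-filter-⊎ R? P? Q? R⇒P⊎Q [] = z≤n
  length-filter-⊎ {P = P} {Q} R? P? Q? R⇒P⊎Q (x ∷ xs) with ih ← length-filter-⊎ R? P? Q? R⇒P⊎Q xs | R? x
  ... | no _ = ≤-trans ih (+-mono-≤ (length-filter-∷ P? x xs) (length-filter-∷ Q? x xs))
  ... | yes r = ≤-trans (s≤s ih) (step (R⇒P⊎Q r))
    where
    step : P x ⊎ Q x → suc (length (filter P? xs) + length (filter Q? xs)) ≤
                   length (filter P? (x ∷ xs)) + length (filter Q? (x ∷ xs))
    step (inj₁ p) = +-mono-≤ (≤-reflexive (cong length (sym (filter-accept P? p)))) (length-filter-∷ Q? x xs)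
    step (inj₂ q) = ≤-trans (≤-reflexive (sym (+-suc _ _)))
      (+-mono-≤ (length-filter-∷ P? x xs) (≤-reflexive (cong length (sym (filter-accept Q? q)))))

  length-filter-cover : ∀ {I : Set} {R : A → Set} {P : I → A → Set}
                        (R? : Decidable R) (P? : ∀ i → Decidable (P i)) (bound : I → ℕ) xs is →
                        (∀ {x} → R x → Any (λ i → P i x) is) →
                        (∀ i → i ∈ᴸ is → length (filter (P? i) xs) ≤ bound i) →
                        length (filter R? xs) ≤ sum (map bound is)
  length-filter-cover {P = P} R? P? bound xs [] covered _ =
    ≤-reflexive (cong length (filter-none R? {xs} (All.tabulate λ _ r → uncovered (covered r))))
    where
    uncovered : ∀ {x} → ¬ Any (λ i → P i x) []
    uncovered ()
  length-filter-cover {R = R} {P} R? P? bound xs (i ∷ is) covered bounded = begin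
    length (filter R? xs)                                  ≤⟨ length-filter-⊎ R? (P? i) P*? split xs ⟩
    length (filter (P? i) xs) + length (filter P*? xs)     ≤⟨ +-mono-≤ (bounded i (here refl)) rest ⟩
    bound i + sum (map bound is)                           ∎
    where
    open ≤-Reasoning
    P*? : Decidable (λ x → Any (λ j → P j x) is)
    P*? x = Any.any? (λ j → P? j x) is
    split : ∀ {x} → R x → P i x ⊎ Any (λ j → P j x) is
    split r with covered r
    ... | here p = inj₁ p
    ... | there p = inj₂ p
    rest : length (filter P*? xs) ≤ sum (map bound is)
    rest = length-filter-cover P*? P? bound xs is (λ p → p) (λ j → bounded j ∘ there)

sum-map-*ˡ : ∀ {I : Set} a (f : I → ℕ) is → sum (map (λ i → a * f i) is) ≡ a * sum (map f is)
sum-map-*ˡ a f [] = sym (*-zeroʳ a)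
sum-map-*ˡ a f (i ∷ is) = begin
  a * f i + sum (map (λ i → a * f i) is) ≡⟨ cong (a * f i +_) (sum-map-*ˡ a f is) ⟩
  a * f i + a * sum (map f is)           ≡⟨ *-distribˡ-+ a (f i) _ ⟨
  a * (f i + sum (map f is))             ∎
  where open ≡-Reasoning

allSubsets-complete : ∀ {k} (S : Subset k) → S ∈ᴸ allSubsets k
allSubsets-complete [] = here refl
allSubsets-complete {suc k} (true ∷ S) = ∈-++⁺ˡ (∈-map⁺ (inside ∷_) (allSubsets-complete S))
allSubsets-complete {suc k} (false ∷ S) =
  ∈-++⁺ʳ (map (inside ∷_) (allSubsets k)) (∈-map⁺ (outside ∷_) (allSubsets-complete S))

allSubsets-unique : ∀ k → Unique (allSubsets k)
allSubsets-unique zero = All.[] ∷ []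
allSubsets-unique (suc k) =
  Unique.++⁺ (Unique.map⁺ ∷-injectiveʳ (allSubsets-unique k)) (Unique.map⁺ ∷-injectiveʳ (allSubsets-unique k))
             disjoint
  where
  disjoint : ∀ {S} → ¬ (S ∈ᴸ map (inside ∷_) (allSubsets k) × S ∈ᴸ map (outside ∷_) (allSubsets k))
  disjoint (S∈ins , S∈outs) with ∈-map⁻ (inside ∷_) S∈ins | ∈-map⁻ (outside ∷_) S∈outs
  ... | _ , _ , refl | _ , _ , ()

length-allSubsets : ∀ k → length (allSubsets k) ≡ 2 ^ k
length-allSubsets zero = refl
length-allSubsets (suc k) = begin
  length (map (inside ∷_) (allSubsets k) ++ map (outside ∷_) (allSubsets k))
    ≡⟨ length-++ (map (inside ∷_) (allSubsets k)) ⟩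
  length (map (inside ∷_) (allSubsets k)) + length (map (outside ∷_) (allSubsets k))
    ≡⟨ cong₂ _+_ (length-map _ (allSubsets k)) (length-map _ (allSubsets k)) ⟩
  length (allSubsets k) + length (allSubsets k)
    ≡⟨ cong (λ l → l + l) (length-allSubsets k) ⟩
  2 ^ k + 2 ^ k
    ≡⟨ cong (2 ^ k +_) (+-identityʳ (2 ^ k)) ⟨
  2 ^ suc k ∎
  where open ≡-Reasoning

length-filter-allSubsets≤ : ∀ {n r} {P : Subset n → Set} (P? : Decidable P) (pos : Fin r → Fin n) →
  (∀ {S S'} → P S → P S' → (∀ k → lookup S (pos k) ≡ lookup S' (pos k)) → S ≡ S') →
  length (filter P? (allSubsets n)) ≤ 2 ^ r
length-filter-allSubsets≤ {n} {r} P? pos determined = begin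
  length Ps            ≡⟨ length-map restrict Ps ⟨
  length (map restrict Ps) ≤⟨ unique∧⊆⇒length≤ (map-unique restrict restrict-injective Ps-unique)
                                (λ {T} _ → allSubsets-complete T) ⟩
  length (allSubsets r) ≡⟨ length-allSubsets r ⟩
  2 ^ r                ∎
  where
  open ≤-Reasoning
  Ps : List (Subset n)
  Ps = filter P? (allSubsets n)
  Ps-unique : Unique Ps
  Ps-unique = Unique.filter⁺ P? (allSubsets-unique n)
  restrict : Subset n → Subset r
  restrict S = tabulate (lookup S ∘ pos)
  restrict-injective : ∀ {S S'} → S ∈ᴸ Ps → S' ∈ᴸ Ps → restrict S ≡ restrict S' → S ≡ S'
  restrict-injective {S} {S'} S∈ S'∈ eq = determined (proj₂ (∈-filter⁻ P? {xs = allSubsets n} S∈))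
                                                (proj₂ (∈-filter⁻ P? {xs = allSubsets n} S'∈)) λ k →
    trans (sym (lookup∘tabulate _ k)) (trans (cong (λ T → lookup T k) eq) (lookup∘tabulate _ k))

∃-prime-∣ : ∀ {d} → 2 ≤ d → ∃ λ p → Prime p × p ∣ d
∃-prime-∣ {1} (s≤s ())
∃-prime-∣ {d@(suc (suc _))} _ with factorise d
... | record { factors = [] ; isFactorisation = () }
... | record { factors = p ∷ ps ; isFactorisation = d≡ ; factorsPrime = p-prime All.∷ _ } =
  p , p-prime , divides (product ps) (trans d≡ (*-comm p (product ps)))

∃-prime-cofactor : ∀ {e n} → e ∣ n → e < n → ∃ λ q → Prime q × e * q ∣ n
∃-prime-cofactor {e} {n} e∣n e<n with ∃-prime-∣ (quotient>1 e∣n e<n)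
... | q , q-prime , q∣n/e = q , q-prime , subst (e * q ∣_) (sym (m∣n⇒n≡m*quotient e∣n)) (*-monoʳ-∣ e q∣n/e)

prime⇒≡suc : ∀ {p} → Prime p → ∃ λ i → p ≡ suc i
prime⇒≡suc {zero} p-prime = ⊥-elim (¬prime[0] p-prime)
prime⇒≡suc {suc i} _ = i , refl

gcd-∣-⊎ : ∀ {a b d} → a ∣ d ⊎ b ∣ d → gcd a b ∣ d
gcd-∣-⊎ {a} {b} (inj₁ a∣d) = ∣-trans (gcd[m,n]∣m a b) a∣d
gcd-∣-⊎ {a} {b} (inj₂ b∣d) = ∣-trans (gcd[m,n]∣n a b) b∣d

foldr-gcd-∣ : ∀ a xs {d} → d ∈ᴸ a ∷ xs → foldr gcd a xs ∣ d
foldr-gcd-∣ a xs {d} d∈a∷xs = foldr-preservesᵒ {P = _∣ d} (λ _ _ → gcd-∣-⊎) a xs (divides-some d∈a∷xs)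
  where
  divides-some : d ∈ᴸ a ∷ xs → a ∣ d ⊎ Any (_∣ d) xs
  divides-some (here refl) = inj₁ ∣-refl
  divides-some (there d∈xs) = inj₂ (Any.map (λ { refl → ∣-refl }) d∈xs)

primeDivisorIndex? : ∀ k → Decidable (λ i → Prime (suc i) × suc i ∣ k)
primeDivisorIndex? k i = prime? (suc i) ×-dec (suc i ∣? k)

primeDivisorIndices : ℕ → List ℕ
primeDivisorIndices k = filter (primeDivisorIndex? k) (upTo k)

∈-primeDivisorIndices : ∀ {i k} .{{_ : NonZero k}} → Prime (suc i) → suc i ∣ k →
                        i ∈ᴸ primeDivisorIndices k
∈-primeDivisorIndices {k = k} p-prime p∣k =
  ∈-filter⁺ (primeDivisorIndex? k) (∈-upTo⁺ (∣⇒≤ p∣k)) (p-prime , p∣k)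

primeDivisorIndices⁻ : ∀ {i k} → i ∈ᴸ primeDivisorIndices k → suc i ∣ k
primeDivisorIndices⁻ {k = k} i∈ = proj₂ (proj₂ (∈-filter⁻ (primeDivisorIndex? k) {xs = upTo k} i∈))

module Cyclic (m : ℕ) where

  n : ℕ
  n = suc m

  infixl 6 _⊕_
  _⊕_ : Fin n → Fin n → Fin n
  _⊕_ = _+ₙ_ m

  [_] : ℕ → Fin n
  [ a ] = a mod n

  toℕ-[] : ∀ a → toℕ [ a ] ≡ a % n
  toℕ-[] a = toℕ-fromℕ< (m%n<n a n)

  toℕ-[]-< : ∀ {a} → a < n → toℕ [ a ] ≡ a
  toℕ-[]-< {a} a<n = trans (toℕ-[] a) (m<n⇒m%n≡m a<n)

  []-cong-% : ∀ a b → a % n ≡ b % n → [ a ] ≡ [ b ]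
  []-cong-% a b eq = toℕ-injective (trans (toℕ-[] a) (trans eq (sym (toℕ-[] b))))

  [toℕ] : ∀ x → [ toℕ x ] ≡ x
  [toℕ] x = toℕ-injective (toℕ-[]-< (toℕ<n x))

  [+kn] : ∀ a k → [ a + k * n ] ≡ [ a ]
  [+kn] a k = []-cong-% (a + k * n) a ([m+kn]%n≡m%n a k n)

  ⊕-[] : ∀ a b → [ a ] ⊕ [ b ] ≡ [ a + b ]
  ⊕-[] a b = []-cong-% (toℕ [ a ] + toℕ [ b ]) (a + b) (begin
    (toℕ [ a ] + toℕ [ b ]) % n ≡⟨ cong₂ (λ u v → (u + v) % n) (toℕ-[] a) (toℕ-[] b) ⟩
    (a % n + b % n) % n         ≡⟨ %-distribˡ-+ a b n ⟨
    (a + b) % n                 ∎)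
    where open ≡-Reasoning

  ∣toℕ[]⇒∣ : ∀ {d a} → d ∣ n → d ∣ toℕ [ a ] → d ∣ a
  ∣toℕ[]⇒∣ {a = a} d∣n d∣[a] = ∣n∣m%n⇒∣m d∣n (subst (_ ∣_) (toℕ-[] a) d∣[a])

  module Subgroup {H : Subset n} (H≤ : IsSubgroup m H) where

    Has : ℕ → Set
    Has a = [ a ] ∈ H

    has-toℕ : ∀ {x} → x ∈ H → Has (toℕ x)
    has-toℕ {x} x∈H = subst (_∈ H) (sym ([toℕ] x)) x∈H

    has-+ : ∀ {a b} → Has a → Has b → Has (a + b)
    has-+ {a} {b} a∈H b∈H = subst (_∈ H) (⊕-[] a b) (proj₁ (proj₂ H≤) [ a ] [ b ] a∈H b∈H)

    has-* : ∀ {a} → Has a → ∀ k → Has (k * a)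
    has-* a∈H zero = proj₁ H≤
    has-* {a} a∈H (suc k) = has-+ {a} {k * a} a∈H (has-* a∈H k)

    has-n : Has n
    has-n = subst (_∈ H) (sym ([]-cong-% n 0 (n%n≡0 n))) (proj₁ H≤)

    -- In a finite group, additive closure already gives cancellation: d ≡ (d + a) + m * a mod n.
    has-cancel : ∀ {a d} → Has a → Has (d + a) → Has d
    has-cancel {a} {d} a∈H d+a∈H = subst (_∈ H) (trans (cong [_] (rearrange d a m)) ([+kn] d a))
                                          (has-+ {d + a} {m * a} d+a∈H (has-* a∈H m))
      where
      open +-*-Solver
      rearrange : ∀ d a m → d + a + m * a ≡ d + a * suc m
      rearrange = solve 3 (λ d a m → d :+ a :+ m :* a := d :+ a :* (con 1 :+ m)) refl

    has-gcd : ∀ {a b} → Has a → Has b → Has (gcd a b)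
    has-gcd {a} {b} a∈H b∈H with Bézout.identity (gcd-GCD a b)
    ... | Bézout.+- x y eq = has-cancel {y * b} {gcd a b} (has-* b∈H y) (subst Has (sym eq) (has-* a∈H x))
    ... | Bézout.-+ x y eq = has-cancel {x * a} {gcd a b} (has-* a∈H x) (subst Has (sym eq) (has-* b∈H y))

    has-/ : ∀ {e q} .{{_ : NonZero q}} → e * q ∣ n → Has e → Has (n / q)
    has-/ {e} {q} (divides s n≡) e∈H = subst Has (sym n/q≡se) (has-* e∈H s)
      where
      n/q≡se : n / q ≡ s * e
      n/q≡se = trans (cong (_/ q) (trans n≡ (sym (*-assoc s e q)))) (m*n/n≡m (s * e) q)

    elements : List ℕ
    elements = map toℕ (filter (_∈? H) (allFin n))

    generator : ℕ
    generator = foldr gcd n elements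

    has-generator : Has generator
    has-generator = foldr-preservesᵇ {P = Has} (λ {a} {b} → has-gcd {a} {b}) has-n
      (All.map⁺ (All.map has-toℕ (All.all-filter (_∈? H) (allFin n))))

    generator-∣n : generator ∣ n
    generator-∣n = foldr-gcd-∣ n elements (here refl)

    generator-∣ : ∀ {x} → x ∈ H → generator ∣ toℕ x
    generator-∣ {x} x∈H = foldr-gcd-∣ n elements (there (∈-map⁺ toℕ (∈-filter⁺ (_∈? H) (∈-allFin x) x∈H)))

  proper⇒∃-prime-∣ : ∀ {H} → IsSubgroup m H → (∃ λ x → x ∉ H) →
                     ∃ λ p → Prime p × p ∣ n × (∀ {x} → x ∈ H → p ∣ toℕ x)
  proper⇒∃-prime-∣ {H} H≤ (x , x∉H) with ∃-prime-∣ 2≤generator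
    where
    open Subgroup H≤
    generator≢1 : generator ≢ 1
    generator≢1 g≡1 = x∉H (subst (_∈ H) (trans (cong [_] (*-identityʳ (toℕ x))) ([toℕ] x))
                                  (has-* (subst Has g≡1 has-generator) (toℕ x)))
    2≤generator : 2 ≤ generator
    2≤generator with generator | generator≢1 | generator-∣n
    ... | 0 | _ | 0∣n = contradiction (0∣⇒≡0 0∣n) λ ()
    ... | 1 | g≢1 | _ = contradiction refl g≢1
    ... | suc (suc _) | _ | _ = s≤s (s≤s z≤n)
  ... | p , p-prime , p∣g = p , p-prime , ∣-trans p∣g generator-∣n , ∣-trans p∣g ∘ generator-∣
    where open Subgroup H≤

  ShiftClosed : ℕ → ℕ → Subset n → Set
  ShiftClosed p c S = ∀ x → x ∈ S → ¬ p ∣ toℕ x → x ⊕ [ c ] ∈ S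

  -- Primes are returned as suc i, suc j: the indexing used by sumPrimeDiv.
  gwc⇒shiftClosed : ∀ {S} → IsGWC m S →
    ∃₂ λ i j → Prime (suc i) × Prime (suc j) × suc i * suc j ∣ n × ShiftClosed (suc i) (n / suc j) S
  gwc⇒shiftClosed {S} (H , K , H≤ , K≤ , (k , k∈K , k≢0) , K⊆H , H-proper , cosets) =
    extract (proper⇒∃-prime-∣ H≤ H-proper) (∃-prime-cofactor e∣n e<n)
    where
    e : ℕ
    e = gcd (toℕ k) n
    e∣n : e ∣ n
    e∣n = gcd[m,n]∣n (toℕ k) n
    e<n : e < n
    e<n = ≤-<-trans (∣⇒≤ {{≢-nonZero (k≢0 ∘ toℕ-injective)}} (gcd[m,n]∣m (toℕ k) n)) (toℕ<n k)
    has-e : [ e ] ∈ K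
    has-e = Subgroup.has-gcd K≤ {toℕ k} {n} (Subgroup.has-toℕ K≤ k∈K) (Subgroup.has-n K≤)
    extract : (∃ λ p → Prime p × p ∣ n × (∀ {x} → x ∈ H → p ∣ toℕ x)) → (∃ λ q → Prime q × e * q ∣ n) →
      ∃₂ λ i j → Prime (suc i) × Prime (suc j) × suc i * suc j ∣ n × ShiftClosed (suc i) (n / suc j) S
    extract (p , p-prime , p∣n , p∣H) (q , q-prime , eq∣n) with prime⇒≡suc p-prime | prime⇒≡suc q-prime
    ... | i , refl | j , refl = i , j , p-prime , q-prime , pq∣n , closed
      where
      pq∣n : p * q ∣ n
      pq∣n = ∣-trans (*-monoˡ-∣ q (gcd-greatest (p∣H (K⊆H k∈K)) p∣n)) eq∣n
      closed : ShiftClosed p (n / q) S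
      closed x x∈S p∤x = proj₁ (cosets x x∈S (p∤x ∘ p∣H) [ n / q ] (Subgroup.has-/ K≤ {e} eq∣n has-e))

  module Orbit {p c q : ℕ} .{{_ : NonZero c}} (cq≡n : c * q ≡ n) (p∣c : p ∣ c)
               {S : Subset n} (closed : ShiftClosed p c S) where

    In : ℕ → Set
    In a = [ a ] ∈ S

    p∣n : p ∣ n
    p∣n = ∣-trans p∣c (divides q (trans (sym cq≡n) (*-comm c q)))

    In-+c : ∀ {a} → ¬ p ∣ a → In a → In (a + c)
    In-+c {a} p∤a a∈S = subst (_∈ S) (⊕-[] a c) (closed [ a ] a∈S (p∤a ∘ ∣toℕ[]⇒∣ p∣n))

    In-+kc : ∀ {a} → ¬ p ∣ a → In a → ∀ k → In (a + k * c)
    In-+kc {a} p∤a a∈S zero = subst In (sym (+-identityʳ a)) a∈S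
    In-+kc {a} p∤a a∈S (suc k) = subst In a+kc+c≡ (In-+c p∤a+kc (In-+kc p∤a a∈S k))
      where
      p∤a+kc : ¬ p ∣ a + k * c
      p∤a+kc p∣a+kc = p∤a (∣m+n∣m⇒∣n (subst (p ∣_) (+-comm a (k * c)) p∣a+kc) (∣n⇒∣m*n k p∣c))
      a+kc+c≡ : a + k * c + c ≡ a + suc k * c
      a+kc+c≡ = trans (+-assoc a (k * c) c) (cong (a +_) (+-comm (k * c) c))

    -- Going once around Zₙ (q steps of c) returns to the start, so the orbit closes up.
    In-% : ∀ {a} → a < n → ¬ p ∣ a → In a → In (a % c)
    In-% {a} a<n p∤a a∈S =
      subst (_∈ S) ([+kn] (a % c) 1) (subst In a+[q-a/c]c≡ (In-+kc p∤a a∈S (q ∸ a / c)))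
      where
      a/c<q : a / c < q
      a/c<q = m<n*o⇒m/o<n (subst (a <_) (trans (sym cq≡n) (*-comm c q)) a<n)
      a+[q-a/c]c≡ : a + (q ∸ a / c) * c ≡ a % c + 1 * n
      a+[q-a/c]c≡ = begin
        a + (q ∸ a / c) * c                     ≡⟨ cong (_+ (q ∸ a / c) * c) (m≡m%n+[m/n]*n a c) ⟩
        a % c + a / c * c + (q ∸ a / c) * c     ≡⟨ +-assoc (a % c) (a / c * c) ((q ∸ a / c) * c) ⟩
        a % c + (a / c * c + (q ∸ a / c) * c)   ≡⟨ cong (a % c +_) (*-distribʳ-+ c (a / c) (q ∸ a / c)) ⟨
        a % c + (a / c + (q ∸ a / c)) * c       ≡⟨ cong (λ z → a % c + z * c) (m+[n∸m]≡n (<⇒≤ a/c<q)) ⟩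
        a % c + q * c                           ≡⟨ cong (a % c +_) (trans (*-comm q c) cq≡n) ⟩
        a % c + n                               ≡⟨ cong (a % c +_) (+-identityʳ n) ⟨
        a % c + 1 * n                           ∎
        where open ≡-Reasoning

    In-%⁻ : ∀ {a} → ¬ p ∣ a → In (a % c) → In a
    In-%⁻ {a} p∤a r∈S =
      subst In (sym (m≡m%n+[m/n]*n a c)) (In-+kc (p∤a ∘ ∣n∣m%n⇒∣m p∣c) r∈S (a / c))

  ShiftClosedConnectionSet : ℕ → ℕ → Subset n → Set
  ShiftClosedConnectionSet p c S = IsConnectionSet m S × ShiftClosed p c S

  shiftClosedConnectionSet? : ∀ p c → Decidable (ShiftClosedConnectionSet p c)
  shiftClosedConnectionSet? p c S = isConnectionSet? m S
    ×-dec all? (λ x → (x ∈? S) →-dec (¬? (p ∣? toℕ x) →-dec (x ⊕ [ c ] ∈? S)))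

  module Count (i j t′ : ℕ) (n≡ : n ≡ suc i * (suc j * suc t′)) where

    p q t c : ℕ
    p = suc i
    q = suc j
    t = suc t′
    c = p * t

    cq≡n : c * q ≡ n
    cq≡n = trans (*-assoc p t q) (trans (cong (p *_) (*-comm t q)) (sym n≡))

    n/q≡c : n / q ≡ c
    n/q≡c = trans (cong (_/ q) (sym cq≡n)) (m*n/n≡m c q)

    p∣c : p ∣ c
    p∣c = divides t (*-comm p t)

    -- Positions 1, …, c - 1 and the multiples p s of p with c ≤ p s < n.
    pos : Fin (c ∸ 1 + j * t) → Fin n
    pos k = [ (λ k₁ → [ suc (toℕ k₁) ]) , (λ k₂ → [ p * (t + toℕ k₂) ]) ]′ (splitAt (c ∸ 1) k)

    pos-below : ∀ {a} → 0 < a → a < c → ∃ λ k → pos k ≡ [ a ]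
    pos-below {suc a} _ a<c = fromℕ< (s<s⁻¹ a<c) ↑ˡ j * t ,
      trans (cong [ _ , _ ]′ (splitAt-↑ˡ (c ∸ 1) (fromℕ< (s<s⁻¹ a<c)) (j * t)))
            (cong (λ z → [ suc z ]) (toℕ-fromℕ< (s<s⁻¹ a<c)))

    pos-above : ∀ {s} → t ≤ s → s < q * t → ∃ λ k → pos k ≡ [ p * s ]
    pos-above {s} t≤s s<qt = (c ∸ 1) ↑ʳ fromℕ< s∸t<jt ,
      trans (cong [ _ , _ ]′ (splitAt-↑ʳ (c ∸ 1) (j * t) (fromℕ< s∸t<jt)))
            (cong (λ z → [ p * z ]) (trans (cong (t +_) (toℕ-fromℕ< s∸t<jt)) (m+[n∸m]≡n t≤s)))
      where
      s∸t<jt : s ∸ t < j * t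
      s∸t<jt = subst (s ∸ t <_) (m+n∸m≡n t (j * t)) (∸-monoˡ-< s<qt t≤s)

    Needed : Fin n → Set
    Needed y = toℕ y ≢ 0 × (toℕ y < c ⊎ p ∣ toℕ y)

    pos-covers : ∀ y → Needed y → ∃ λ k → pos k ≡ y
    pos-covers y (y≢0 , below-or-multiple) with toℕ y <? c | below-or-multiple
    ... | yes y<c | _ = let k , eq = pos-below (n≢0⇒n>0 y≢0) y<c in k , trans eq ([toℕ] y)
    ... | no y≮c | inj₁ y<c = contradiction y<c y≮c
    ... | no y≮c | inj₂ (divides s y≡sp) = let k , eq = pos-above t≤s s<qt in k , trans eq [ps]≡y
      where
      t≤s : t ≤ s
      t≤s = *-cancelʳ-≤ t s p (subst₂ _≤_ (*-comm p t) y≡sp (≮⇒≥ y≮c))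
      s<qt : s < q * t
      s<qt = *-cancelʳ-< p s (q * t) (subst₂ _<_ y≡sp (trans n≡ (*-comm p (q * t))) (toℕ<n y))
      [ps]≡y : [ p * s ] ≡ y
      [ps]≡y = trans (cong [_] (trans (*-comm p s) (sym y≡sp))) ([toℕ] y)

    ⊆-if-needed : ∀ {S S'} → IsConnectionSet m S → ShiftClosed p c S → ShiftClosed p c S' →
                  (∀ y → Needed y → y ∈ S → y ∈ S') → S ⊆ S'
    ⊆-if-needed {S} {S'} 0∉S closed closed' needed {x} x∈S with p ∣? toℕ x
    ... | yes p∣x = needed x (x≢0 , inj₂ p∣x) x∈S
      where
      x≢0 : toℕ x ≢ 0
      x≢0 x≡0 = 0∉S (subst (_∈ S) (toℕ-injective x≡0) x∈S)
    ... | no p∤x = subst (_∈ S') ([toℕ] x) (Orbit.In-%⁻ cq≡n p∣c closed' p∤x r∈S')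
      where
      a r : ℕ
      a = toℕ x
      r = a % c
      p∤r : ¬ p ∣ r
      p∤r = p∤x ∘ ∣n∣m%n⇒∣m p∣c
      toℕ-r : toℕ [ r ] ≡ r
      toℕ-r = toℕ-[]-< (<-≤-trans (m%n<n a c) (subst (c ≤_) cq≡n (m≤m*n c q)))
      r∈S : [ r ] ∈ S
      r∈S = Orbit.In-% cq≡n p∣c closed (toℕ<n x) p∤x (subst (_∈ S) (sym ([toℕ] x)) x∈S)
      r∈S' : [ r ] ∈ S'
      r∈S' = needed [ r ] ((λ r≡0 → p∤r (subst (p ∣_) (trans (sym r≡0) toℕ-r) (p ∣0)))
                          , inj₁ (subst (_< c) (sym toℕ-r) (m%n<n a c)))
                    r∈S

    agree⇒needed : ∀ {S S'} → (∀ k → lookup S (pos k) ≡ lookup S' (pos k)) →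
                   ∀ y → Needed y → y ∈ S → y ∈ S'
    agree⇒needed {S} {S'} agree y needed y∈S with pos-covers y needed
    ... | k , refl = lookup⇒[]= (pos k) S' (trans (sym (agree k)) ([]=⇒lookup y∈S))

    count : length (filter (shiftClosedConnectionSet? p c) (allSubsets n)) ≤ 2 ^ (c ∸ 1 + j * t)
    count = length-filter-allSubsets≤ (shiftClosedConnectionSet? p c) pos
      λ (0∉S , closed) (0∉S' , closed') agree →
        ⊆-antisym (⊆-if-needed 0∉S closed closed' (agree⇒needed agree))
                  (⊆-if-needed 0∉S' closed' closed (agree⇒needed (sym ∘ agree)))

    n/p≡qt : n / p ≡ q * t
    n/p≡qt = trans (cong (_/ p) (trans n≡ (*-comm p (q * t)))) (m*n/n≡m (q * t) p)

    [n∸n/p]/q≡it : (n ∸ n / p) / q ≡ i * t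
    [n∸n/p]/q≡it = begin
      (n ∸ n / p) / q           ≡⟨ cong₂ (λ u v → (u ∸ v) / q) n≡ n/p≡qt ⟩
      (p * (q * t) ∸ q * t) / q ≡⟨ cong (_/ q) (m+n∸m≡n (q * t) (i * (q * t))) ⟩
      i * (q * t) / q           ≡⟨ cong (λ z → i * z / q) (*-comm q t) ⟩
      i * (t * q) / q           ≡⟨ cong (_/ q) (*-assoc i t q) ⟨
      i * t * q / q             ≡⟨ m*n/n≡m (i * t) q ⟩
      i * t                     ∎
      where open ≡-Reasoning

    exponent : c ∸ 1 + j * t ≡ (n / p ∸ 1) + (n ∸ n / p) / q
    exponent = begin
      t′ + i * t + j * t    ≡⟨ swap t′ (i * t) (j * t) ⟩
      t′ + j * t + i * t    ≡⟨ cong₂ (λ u v → u ∸ 1 + v) n/p≡qt [n∸n/p]/q≡it ⟨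
      (n / p ∸ 1) + (n ∸ n / p) / q ∎
      where
      open ≡-Reasoning
      open +-*-Solver
      swap : ∀ a b d → a + b + d ≡ a + d + b
      swap = solve 3 (λ a b d → a :+ b :+ d := a :+ d :+ b) refl

    count-bound : length (filter (shiftClosedConnectionSet? p (n / q)) (allSubsets n)) ≤
                  2 ^ (n / p ∸ 1) * 2 ^ ((n ∸ n / p) / q)
    count-bound = begin
      length (filter (shiftClosedConnectionSet? p (n / q)) (allSubsets n))
        ≡⟨ cong (λ d → length (filter (shiftClosedConnectionSet? p d) (allSubsets n))) n/q≡c ⟩
      length (filter (shiftClosedConnectionSet? p c) (allSubsets n))
        ≤⟨ count ⟩
      2 ^ (c ∸ 1 + j * t)
        ≡⟨ cong (2 ^_) exponent ⟩
      2 ^ ((n / p ∸ 1) + (n ∸ n / p) / q)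
        ≡⟨ ^-distribˡ-+-* 2 (n / p ∸ 1) ((n ∸ n / p) / q) ⟩
      2 ^ (n / p ∸ 1) * 2 ^ ((n ∸ n / p) / q) ∎
      where open ≤-Reasoning

  count-shiftClosed : ∀ i j → suc i ∣ n → suc j ∣ n / suc i →
    length (filter (shiftClosedConnectionSet? (suc i) (n / suc j)) (allSubsets n)) ≤
    2 ^ (n / suc i ∸ 1) * 2 ^ ((n ∸ n / suc i) / suc j)
  count-shiftClosed i j p∣n (divides zero n/p≡0) =
    contradiction (trans (sym (m*[n/m]≡n p∣n)) (trans (cong (suc i *_) n/p≡0) (*-zeroʳ (suc i)))) λ ()
  count-shiftClosed i j p∣n (divides (suc t′) n/p≡tq) = Count.count-bound i j t′ n≡
    where
    n≡ : n ≡ suc i * (suc j * suc t′)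
    n≡ = trans (sym (m*[n/m]≡n p∣n)) (cong (suc i *_) (trans n/p≡tq (*-comm (suc t′) (suc j))))

  SomeShiftClosedConnectionSet : ℕ → Subset n → Set
  SomeShiftClosedConnectionSet i S =
    Any (λ j → ShiftClosedConnectionSet (suc i) (n / suc j) S) (primeDivisorIndices (n / suc i))

  someShiftClosedConnectionSet? : ∀ i → Decidable (SomeShiftClosedConnectionSet i)
  someShiftClosedConnectionSet? i S =
    Any.any? (λ j → shiftClosedConnectionSet? (suc i) (n / suc j) S) (primeDivisorIndices (n / suc i))

  gwc⇒someShiftClosedConnectionSet : ∀ {S} → IsConnectionSet m S × IsGWC m S →
    Any (λ i → SomeShiftClosedConnectionSet i S) (primeDivisorIndices n)
  gwc⇒someShiftClosedConnectionSet (0∉S , gwc) with gwc⇒shiftClosed gwc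
  ... | i , j , p-prime , q-prime , pq∣n , closed =
    lose (∈-primeDivisorIndices p-prime p∣n)
         (lose (∈-primeDivisorIndices {{n/p≢0}} q-prime (m*n∣o⇒n∣o/m (suc i) (suc j) pq∣n)) (0∉S , closed))
    where
    p∣n : suc i ∣ n
    p∣n = ∣-trans (m∣m*n (suc j)) pq∣n
    n/p≢0 : NonZero (n / suc i)
    n/p≢0 = >-nonZero (m≥n⇒m/n>0 (∣⇒≤ p∣n))

lemma2p12 : (m : ℕ) → numGWC m ≤ gwcBound (suc m)
lemma2p12 m = length-filter-cover _ someShiftClosedConnectionSet? bound (allSubsets n) (primeDivisorIndices n)
                gwc⇒someShiftClosedConnectionSet bounded
  where
  open Cyclic m
  bound : ℕ → ℕ
  bound i = 2 ^ (n / suc i ∸ 1) * sumPrimeDiv (n / suc i) (λ q → 2 ^ ((n ∸ n / suc i) / q))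
  bounded : ∀ i → i ∈ᴸ primeDivisorIndices n →
            length (filter (someShiftClosedConnectionSet? i) (allSubsets n)) ≤ bound i
  bounded i i∈ = begin
    length (filter (someShiftClosedConnectionSet? i) (allSubsets n))
      ≤⟨ length-filter-cover (someShiftClosedConnectionSet? i) _ (λ j → a * b j) (allSubsets n) js (λ s → s)
           (λ j j∈ → count-shiftClosed i j (primeDivisorIndices⁻ i∈) (primeDivisorIndices⁻ j∈)) ⟩
    sum (map (λ j → a * b j) js)
      ≡⟨ sum-map-*ˡ a b js ⟩
    bound i ∎
    where
    open ≤-Reasoning
    js : List ℕ
    js = primeDivisorIndices (n / suc i)
    a : ℕ
    a = 2 ^ (n / suc i ∸ 1)
    b : ℕ → ℕ
    b j = 2 ^ ((n ∸ n / suc i) / suc j)
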